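{- Let $G$ be a connected graph and let $X\subseteq V(G)$ be a twin cover of $G$ with $|X|=t$. Then $\chi(G)\le \operatorname{svcfc}(G)\le \chi(G)+t$.
   Context: All graphs are finite, simple and undirected. For a vertex coloring $c\colon V(G)\to\mathbb{N}$, a path is conflict-free if some color appears on exactly one of its vertices. A coloring of a connected graph $G$ is a strong CFVC coloring if every two distinct vertices $u,v$ are joined by a conflict-free shortest $u$-$v$ path. $\operatorname{svcfc}(G)$ is the minimum number of colors of a strong CFVC coloring of $G$; $\chi(G)$ is the chromatic number. Vertices $u\neq v$ are true twins if $N_G[u]=N_G[v]$; a twin edge is an edge whose endpoints are true twins; $X\subseteq V(G)$ is a twin cover if every edge of $G-X$ is a twin edge. -}

module Defs where

open import Data.Nat using (ℕ; zero; suc; _≤_)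
open import Data.Bool using (Bool; true; false)
open import Data.Fin using (Fin)
open import Data.Fin.Subset using (Subset; _∈_; _∉_; ∣_∣)
open import Data.List using (List; []; _∷_)
open import Data.List.Relation.Unary.All using (All)
open import Data.List.Relation.Unary.Unique.Propositional using (Unique)
import Data.List.Membership.Propositional as LM
open import Data.Product using (Σ; ∃; _×_; _,_)
open import Data.Sum using (_⊎_)
open import Relation.Binary.PropositionalEquality using (_≡_; _≢_)
open import Relation.Nullary using (¬_)
open import Function.Bundles using (_⇔_)

record Graph (n : ℕ) : Set where
  field
    adj     : Fin n → Fin n → Bool
    adj-sym : ∀ u v → adj u v ≡ adj v u
    adj-irr : ∀ u → adj u u ≡ false

module _ {n : ℕ} (G : Graph n) where
  open Graph G

  Adj : Fin n → Fin n → Set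
  Adj u v = adj u v ≡ true

  data Walk : Fin n → Fin n → Set where
    [_] : ∀ u → Walk u u
    step : ∀ u {v w} → Adj u v → Walk v w → Walk u w

  verts : ∀ {u v} → Walk u v → List (Fin n)
  verts [ u ] = u ∷ []
  verts (step u _ p) = u ∷ verts p

  len : ∀ {u v} → Walk u v → ℕ
  len [ u ] = zero
  len (step u _ p) = suc (len p)

  IsPath : ∀ {u v} → Walk u v → Set
  IsPath p = Unique (verts p)

  IsShortestPath : ∀ {u v} → Walk u v → Set
  IsShortestPath {u} {v} p = IsPath p × (∀ (q : Walk u v) → IsPath q → len p ≤ len q)

  Connected : Set
  Connected = ∀ u v → Σ (Walk u v) IsPath

  InClosedNbhd : Fin n → Fin n → Set
  InClosedNbhd u w = w ≡ u ⊎ Adj u w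

  TrueTwins : Fin n → Fin n → Set
  TrueTwins u v = u ≢ v × (∀ w → InClosedNbhd u w ⇔ InClosedNbhd v w)

  IsTwinCover : Subset n → Set
  IsTwinCover X = ∀ u v → u ∉ X → v ∉ X → Adj u v → TrueTwins u v

  IsProper : ∀ {k} → (Fin n → Fin k) → Set
  IsProper c = ∀ u v → Adj u v → c u ≢ c v

  ConflictFree : ∀ {k} → (Fin n → Fin k) → List (Fin n) → Set
  ConflictFree c xs = ∃ λ x → x LM.∈ xs × All (λ y → c y ≡ c x → y ≡ x) xs

  IsStrongCFVC : ∀ {k} → (Fin n → Fin k) → Set
  IsStrongCFVC c = ∀ u v → u ≢ v →
    Σ (Walk u v) λ p → IsShortestPath p × ConflictFree c (verts p)

  Colourable : ℕ → Set
  Colourable k = Σ (Fin n → Fin k) IsProper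

  StrongCFVCColourable : ℕ → Set
  StrongCFVCColourable k = Σ (Fin n → Fin k) IsStrongCFVC

IsMinimum : (ℕ → Set) → ℕ → Set
IsMinimum P k = P k × (∀ m → P m → k ≤ m)

IsChromaticNumber : ∀ {n} → Graph n → ℕ → Set
IsChromaticNumber G = IsMinimum (Colourable G)

IsSvcfc : ∀ {n} → Graph n → ℕ → Set
IsSvcfc G = IsMinimum (StrongCFVCColourable G)

-- χ ≤ svcfc because a strong CFVC colouring is proper: the only shortest path between adjacent
-- vertices is the edge itself, and it is conflict-free only if its ends differ in colour. Conversely,
-- keep an optimal proper colouring c outside X and give each of the t vertices of X a fresh
-- colour of its own. A shortest path meeting X is conflict-free through such a vertex. A
-- shortest path avoiding X is a single edge: in G − X every edge joins true twins, and if the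
-- path went on from u through its twin w to x, then x would be adjacent to u as well, giving a
-- shorter path.
module Submission where

open import Defs
open import Data.Nat using (ℕ; _≤_; _+_)
open import Data.Fin.Subset using (Subset; ∣_∣)
open import Data.Product using (_×_)
open import Relation.Binary.PropositionalEquality using (_≡_)

open import Data.Nat using (zero; suc; z≤n; s≤s)
open import Data.Nat.Properties using (≤-refl; ≤-trans; n≤1+n; n≮n; suc-injective)
open import Data.Bool using (true; false) renaming (_≟_ to _≟ᵇ_)
open import Data.Fin using (Fin; splitAt; join) renaming (_≟_ to _≟ᶠ_)
open import Data.Fin.Properties using (any?; splitAt-join) renaming (suc-injective to sucᶠ-injective)
open import Data.Fin.Subset using (_∈_; _∉_)
open import Data.Fin.Subset.Properties using (_∈?_)
open import Data.Vec using (_∷_; here; there)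
open import Data.List using ([]; _∷_)
open import Data.List.Relation.Unary.All as All using (All; []; _∷_)
open import Data.List.Relation.Unary.All.Properties using (¬Any⇒All¬)
open import Data.List.Relation.Unary.Any as Any using (here; there)
open import Data.List.Relation.Unary.AllPairs using ([]; _∷_)
import Data.List.Membership.Propositional as List
open import Data.Product using (Σ; ∃; _,_; proj₁)
open import Data.Sum using (_⊎_; inj₁; inj₂)
open import Data.Sum.Properties using (inj₁-injective; inj₂-injective)
open import Function using (_∘_; case_of_)
open import Function.Bundles using (Equivalence)
open import Relation.Binary.PropositionalEquality using (_≢_; refl; sym; trans; cong)
open import Relation.Nullary using (Dec; yes; no; contradiction)
open import Relation.Nullary.Decidable using (map′; _×-dec_)
open import Relation.Unary using (Decidable)

minimum : (P : ℕ → Set) → Decidable P → ∀ {k} → P k → ∃ (IsMinimum P)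
minimum P P? {zero} p = zero , p , λ _ _ → z≤n
minimum P P? {suc k} p with P? zero
... | yes p₀ = zero , p₀ , λ _ _ → z≤n
... | no ¬p₀ with minimum (P ∘ suc) (P? ∘ suc) p
...   | m , pm , least = suc m , pm , λ { zero p₀ → contradiction p₀ ¬p₀
                                        ; (suc j) pj → s≤s (least j pj) }

join-injective : ∀ m n {i j : Fin m ⊎ Fin n} → join m n i ≡ join m n j → i ≡ j
join-injective m n {i} {j} eq =
  trans (sym (splitAt-join m n i)) (trans (cong (splitAt m) eq) (splitAt-join m n j))

rank : ∀ {n} (X : Subset n) {x : Fin n} → x ∈ X → Fin ∣ X ∣
rank (true ∷ X) here = Fin.zero
rank (true ∷ X) (there x∈X) = Fin.suc (rank X x∈X)
rank (false ∷ X) (there x∈X) = rank X x∈X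

rank-injective : ∀ {n} (X : Subset n) {x y : Fin n} (x∈X : x ∈ X) (y∈X : y ∈ X) →
                 rank X x∈X ≡ rank X y∈X → x ≡ y
rank-injective (true ∷ X) here here eq = refl
rank-injective (true ∷ X) (there x∈X) (there y∈X) eq =
  cong Fin.suc (rank-injective X x∈X y∈X (sucᶠ-injective eq))
rank-injective (false ∷ X) (there x∈X) (there y∈X) eq =
  cong Fin.suc (rank-injective X x∈X y∈X eq)

module _ {n : ℕ} (G : Graph n) where
  open Graph G

  WalkOfLength : ℕ → Fin n → Fin n → Set
  WalkOfLength k u v = Σ (Walk G u v) λ p → len G p ≡ k

  walkOfLength? : ∀ k u v → Dec (WalkOfLength k u v)
  walkOfLength? zero u v with u ≟ᶠ v
  ... | yes refl = yes ([ u ] , refl)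
  ... | no u≢v = no λ { ([ _ ] , _) → u≢v refl ; (step _ _ _ , ()) }
  walkOfLength? (suc k) u v =
    map′ extend restrict (any? λ w → (adj u w ≟ᵇ true) ×-dec walkOfLength? k w v)
    where
    extend : (∃ λ w → Adj G u w × WalkOfLength k w v) → WalkOfLength (suc k) u v
    extend (_ , a , p , refl) = step u a p , refl
    restrict : WalkOfLength (suc k) u v → ∃ λ w → Adj G u w × WalkOfLength k w v
    restrict (step _ a p , eq) = _ , a , p , suc-injective eq

  head∈verts : ∀ {u v} (p : Walk G u v) → u List.∈ verts G p
  head∈verts [ _ ] = here refl
  head∈verts (step _ _ _) = here refl

  dropUntil : ∀ {u v x} (p : Walk G u v) → x List.∈ verts G p → IsPath G p →
              Σ (Walk G x v) λ q → IsPath G q × len G q ≤ len G p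
  dropUntil [ _ ] (here refl) path = [ _ ] , path , z≤n
  dropUntil p@(step _ _ _) (here refl) path = p , path , ≤-refl
  dropUntil (step _ _ p) (there x∈p) (_ ∷ path) with dropUntil p x∈p path
  ... | q , q-path , q≤p = q , q-path , ≤-trans q≤p (n≤1+n _)

  loopErase : ∀ {u v} (p : Walk G u v) → Σ (Walk G u v) λ q → IsPath G q × len G q ≤ len G p
  loopErase [ u ] = [ u ] , [] ∷ [] , z≤n
  loopErase (step u a p) with loopErase p
  ... | q , q-path , q≤p with Any.any? (u ≟ᶠ_) (verts G q)
  ...   | yes u∈q with dropUntil q u∈q q-path
  ...     | r , r-path , r≤q = r , r-path , ≤-trans r≤q (≤-trans q≤p (n≤1+n _))
  loopErase (step u a p) | q , q-path , q≤p | no u∉q =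
    step u a q , ¬Any⇒All¬ _ u∉q ∷ q-path , s≤s q≤p

  shortestPath : Connected G → ∀ u v → Σ (Walk G u v) (IsShortestPath G)
  shortestPath conn u v
    with minimum (λ k → WalkOfLength k u v) (λ k → walkOfLength? k u v) (proj₁ (conn u v) , refl)
  ... | _ , (p , refl) , least with loopErase p
  ...   | q , q-path , q≤p = q , q-path , λ r _ → ≤-trans q≤p (least (len G r) (r , refl))

  adjacent⇒≢ : ∀ {u v} → Adj G u v → u ≢ v
  adjacent⇒≢ {u} a refl with trans (sym (adj-irr u)) a
  ... | ()

  edgePath : ∀ {u v} (a : Adj G u v) → IsPath G (step u a [ v ])
  edgePath a = (adjacent⇒≢ a ∷ []) ∷ [] ∷ []

  shortestPath-adjacent : ∀ {u v} → Adj G u v → u ≢ v → (p : Walk G u v) → IsShortestPath G p →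
                          verts G p ≡ u ∷ v ∷ []
  shortestPath-adjacent a u≢v [ _ ] _ = contradiction refl u≢v
  shortestPath-adjacent a u≢v (step _ _ [ _ ]) _ = refl
  shortestPath-adjacent a u≢v (step _ _ (step _ _ _)) (_ , shortest)
    with shortest (step _ a [ _ ]) (edgePath a)
  ... | s≤s ()

  -- In a shortest path the edge u w is followed by w x with x ≠ u; a twin of w is adjacent to x.
  shortestPath-twinStart : ∀ {u w v} (a : Adj G u w) (p : Walk G w v) →
                           IsShortestPath G (step u a p) → TrueTwins G u w → len G p ≡ 0
  shortestPath-twinStart a [ _ ] _ _ = refl
  shortestPath-twinStart {u} a (step _ {x} b q) ((_ ∷ u∉q) ∷ (_ ∷ path) , shortest) (_ , twins)
    with Equivalence.from (twins x) (inj₂ b)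
  ... | inj₁ x≡u = contradiction (sym x≡u) (All.lookup u∉q (head∈verts q))
  ... | inj₂ a′ = contradiction (shortest (step u a′ q) (u∉q ∷ path)) (n≮n _)

  module _ {k} (c : Fin n → Fin k) where

    conflictFree-pair⇒≢ : ∀ {u v} → u ≢ v → ConflictFree G c (u ∷ v ∷ []) → c u ≢ c v
    conflictFree-pair⇒≢ u≢v (_ , here refl , _ ∷ onlyU ∷ []) cu≡cv = u≢v (sym (onlyU (sym cu≡cv)))
    conflictFree-pair⇒≢ u≢v (_ , there (here refl) , onlyV ∷ _) cu≡cv = u≢v (onlyV cu≡cv)

    ≢⇒conflictFree-pair : ∀ {u v} → c u ≢ c v → ConflictFree G c (u ∷ v ∷ [])
    ≢⇒conflictFree-pair cu≢cv =
      _ , here refl , (λ _ → refl) ∷ (λ eq → contradiction (sym eq) cu≢cv) ∷ []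

    strongCFVC⇒proper : IsStrongCFVC G c → IsProper G c
    strongCFVC⇒proper strong u v a with strong u v (adjacent⇒≢ a)
    ... | p , shortest , cf rewrite shortestPath-adjacent a (adjacent⇒≢ a) p shortest =
      conflictFree-pair⇒≢ (adjacent⇒≢ a) cf

module TwinCoverColouring {n} (G : Graph n) (X : Subset n) (twinCover : IsTwinCover G X)
                          {χ} (c : Fin n → Fin χ) (proper : IsProper G c) where

  colour⊎ : Fin n → Fin χ ⊎ Fin ∣ X ∣
  colour⊎ v with v ∈? X
  ... | yes v∈X = inj₂ (rank X v∈X)
  ... | no _ = inj₁ (c v)

  colour : Fin n → Fin (χ + ∣ X ∣)
  colour = join χ ∣ X ∣ ∘ colour⊎

  colour-unique-on-X : ∀ {x} → x ∈ X → ∀ y → colour y ≡ colour x → y ≡ x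
  colour-unique-on-X {x} x∈X y with x ∈? X | y ∈? X
  ... | no x∉X | _ = contradiction x∈X x∉X
  ... | yes x∈X′ | yes y∈X = rank-injective X y∈X x∈X′ ∘ inj₂-injective ∘ join-injective χ ∣ X ∣
  ... | yes x∈X′ | no _ = λ eq →
    case join-injective χ ∣ X ∣ {inj₁ (c y)} {inj₂ (rank X x∈X′)} eq of λ ()

  colour-proper-outside-X : ∀ {u v} → u ∉ X → v ∉ X → Adj G u v → colour u ≢ colour v
  colour-proper-outside-X {u} {v} u∉X v∉X a with u ∈? X | v ∈? X
  ... | yes u∈X | _ = contradiction u∈X u∉X
  ... | no _ | yes v∈X = contradiction v∈X v∉X
  ... | no _ | no _ = proper u v a ∘ inj₁-injective ∘ join-injective χ ∣ X ∣

  conflictFree-outside-X : ∀ {u v} (p : Walk G u v) → IsShortestPath G p → u ≢ v →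
                           All (_∉ X) (verts G p) → ConflictFree G colour (verts G p)
  conflictFree-outside-X [ _ ] _ u≢v _ = contradiction refl u≢v
  conflictFree-outside-X (step _ a [ _ ]) _ _ (u∉X ∷ v∉X ∷ []) =
    ≢⇒conflictFree-pair G colour (colour-proper-outside-X u∉X v∉X a)
  conflictFree-outside-X (step u a p@(step _ _ _)) shortest _ (u∉X ∷ w∉X ∷ _)
    with shortestPath-twinStart G a p shortest (twinCover _ _ u∉X w∉X a)
  ... | ()

  conflictFree-shortestPath : ∀ {u v} (p : Walk G u v) → IsShortestPath G p → u ≢ v →
                              ConflictFree G colour (verts G p)
  conflictFree-shortestPath p shortest u≢v with Any.any? (_∈? X) (verts G p)
  ... | yes meetsX with List.find meetsX
  ...   | x , x∈p , x∈X = x , x∈p , All.tabulate λ {y} _ → colour-unique-on-X x∈X y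
  conflictFree-shortestPath p shortest u≢v | no avoidsX =
    conflictFree-outside-X p shortest u≢v (¬Any⇒All¬ _ avoidsX)

  colour-strongCFVC : Connected G → IsStrongCFVC G colour
  colour-strongCFVC conn u v u≢v with shortestPath G conn u v
  ... | p , shortest = p , shortest , conflictFree-shortestPath p shortest u≢v

corollary4 : ∀ {n} (G : Graph n) → Connected G →
    (X : Subset n) → IsTwinCover G X →
    (t χ s : ℕ) → ∣ X ∣ ≡ t → IsChromaticNumber G χ → IsSvcfc G s →
    χ ≤ s × s ≤ χ + t
corollary4 G conn X twinCover _ χ s refl ((c , proper) , χ-least) ((d , strong) , s-least) =
  χ-least s (d , strongCFVC⇒proper G d strong) ,
  s-least (χ + ∣ X ∣) (colour , colour-strongCFVC conn)
  where open TwinCoverColouring G X twinCover c proper
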